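{- For every positive integer $h$, there is a bijection between $\Omega_{pos}(h)$ and the set $\Omega_{f^4}(h)$ of configurations defined below.
   Context: For a positive integer $h$, let $\Omega(h)$ (the set of states of the paper's dynamic program for the rectilinear TSP) be the set of pairs $(x,\pi)$ where $x=(x_1,\dots,x_h)\in\{0,U,E\}^h$ and $\pi$ is a partition of $Z=\{i : x_i \neq 0\}$ that is non-crossing (i.e., there are no $a<b<c<d$ in $Z$ with $a,c$ in one block and $b,d$ in a different block), such that every block of $\pi$ contains an even number (possibly zero) of indices $i$ with $x_i=U$, and every singleton block $\{i\}$ has $x_i=E$. (Here $0$, $U$, $E$ stand for zero, odd, and even positive degree.) Let $\Omega_{pos}(h)\subseteq\Omega(h)$ be the subset of pairs with $x_i\neq 0$ for all $i$. $\Omega_{f^4}(h)$ is the set of configurations consisting of $h$ points $p_1<\dots<p_h$ on a horizontal line together with a set of edges (arcs) drawn above the line, each joining two distinct points and colored black or white, such that no two edges cross (there are no edges $\{p_a,p_c\}$ and $\{p_b,p_d\}$ with $a<b<c<d$) and whenever two edges share an endpoint $p$, then $p$ is the left endpoint of both edges. -}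

module Defs where

open import Level using (0ℓ)
open import Data.Nat using (ℕ; _+_)
open import Data.Nat.Divisibility using (_∣_)
open import Data.Fin using (Fin; _<_)
open import Data.Bool using (Bool; true; false; T; _∧_; if_then_else_)
open import Data.List using (List; map; allFin)
open import Data.Nat.ListAction using (sum)
open import Data.Maybe using (Maybe; just; nothing; Is-just)
open import Data.Product using (Σ; _×_; _,_; proj₁; proj₂)
open import Data.Sum using (_⊎_)
open import Relation.Nullary using (¬_)
open import Relation.Binary.PropositionalEquality using (_≡_; _≢_; refl; sym; trans)
open import Relation.Binary.Bundles using (Setoid)
open import Relation.Binary.Structures using (IsEquivalence)

-- degree labels: 0 (zero), U (odd positive), E (even positive)
data Deg : Set where
  zro U E : Deg

isU : Deg → Bool
isU U = true
isU _ = false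

countU : {h : ℕ} → (Fin h → Deg) → (Fin h → Fin h → Bool) → Fin h → ℕ
countU {h} x R i = sum (map (λ j → if R i j ∧ isU (x j) then 1 else 0) (allFin h))

-- A state (x , π) of Ω(h).  The partition π of Z = {i | x i ≠ 0} is
-- represented by its equivalence relation R ("i and j lie in the same block"),
-- which relates only elements of Z.
record Ω (h : ℕ) : Set where
  field
    x : Fin h → Deg
    R : Fin h → Fin h → Bool
    R-supp  : ∀ i j → T (R i j) → (x i ≢ zro) × (x j ≢ zro)
    R-refl  : ∀ i → x i ≢ zro → T (R i i)
    R-sym   : ∀ i j → T (R i j) → T (R j i)
    R-trans : ∀ i j k → T (R i j) → T (R j k) → T (R i k)
    noncrossing : ∀ a b c d → a < b → b < c → c < d →
                  ¬ (T (R a c) × T (R b d) × ¬ T (R a b))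
    evenU : ∀ i → x i ≢ zro → 2 ∣ countU x R i
    singletonE : ∀ i → x i ≢ zro → (∀ j → T (R i j) → j ≡ i) → x i ≡ E

open Ω public

Ωpos : ℕ → Set
Ωpos h = Σ (Ω h) (λ s → ∀ i → x s i ≢ zro)

Ωpos-setoid : ℕ → Setoid 0ℓ 0ℓ
Ωpos-setoid h = record
  { Carrier = Ωpos h
  ; _≈_ = λ s t → (∀ i → x (proj₁ s) i ≡ x (proj₁ t) i)
                × (∀ i j → R (proj₁ s) i j ≡ R (proj₁ t) i j)
  ; isEquivalence = record
    { refl  = (λ _ → refl) , (λ _ _ → refl)
    ; sym   = λ p → (λ i → sym (proj₁ p i)) , (λ i j → sym (proj₂ p i j))
    ; trans = λ p q → (λ i → trans (proj₁ p i) (proj₁ q i))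
                    , (λ i j → trans (proj₂ p i j) (proj₂ q i j))
    }
  }

data Color : Set where
  black white : Color

-- Configurations of Ω_{f⁴}(h): points p_1 < ... < p_h identified with Fin h;
-- col a b = just c  iff there is an arc {p_a , p_b} (with a < b) of colour c.
record F4 (h : ℕ) : Set where
  field
    col : Fin h → Fin h → Maybe Color
    col-ordered : ∀ a b → Is-just (col a b) → a < b
    noncrossing : ∀ a b c d → a < b → b < c → c < d →
                  ¬ (Is-just (col a c) × Is-just (col b d))
    shared-left : ∀ a b c d → Is-just (col a b) → Is-just (col c d) →
                  ¬ (a ≡ c × b ≡ d) → ∀ p → (p ≡ a ⊎ p ≡ b) → (p ≡ c ⊎ p ≡ d) →
                  (p ≡ a × p ≡ c)

open F4 public

F4-setoid : ℕ → Setoid 0ℓ 0ℓ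
F4-setoid h = record
  { Carrier = F4 h
  ; _≈_ = λ s t → ∀ i j → col s i j ≡ col t i j
  ; isEquivalence = record
    { refl  = λ _ _ → refl
    ; sym   = λ p i j → sym (p i j)
    ; trans = λ p q i j → trans (p i j) (q i j)
    }
  }

module Submission where

-- A state with positive degrees is sent to the configuration joining the least element
-- (the leader) of each block to every other element of the block, the arc into j being
-- white when x j = U and black when x j = E.  Non-crossing blocks give non-crossing arcs,
-- and a point shared by two arcs is a leader, hence the left endpoint of both.
-- Conversely, in a configuration of Ω_{f⁴} no point is both a left and a right endpoint
-- and no point has two arcs coming in from the left, so the arcs form disjoint stars
-- hanging from their roots, and the stars are the blocks.  The degree of a non-root is
-- read off the colour of its incoming arc, and the degree of a root is forced by the
-- parity condition on its block: it is U exactly when the root has an odd number of white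
-- arcs (so E for an isolated point, as the singleton condition demands).

open import Defs
open import Data.Nat using (ℕ; _≤_; zero; suc; _+_; parity)
open import Function.Bundles using (Bijection; Equivalence)

import Algebra.Properties.CommutativeMonoid.Sum as CommutativeMonoidSum
open import Data.Bool using (Bool; true; false; T; _∧_; if_then_else_)
open import Data.Bool.Properties using (T-≡)
open import Data.Empty using (⊥-elim)
open import Data.Fin as F using (Fin; zero; suc; _<_; punchIn)
open import Data.Fin.Properties
  using (_≟_; _<?_; <-cmp; <-irrefl; <-trans; <⇒≢; ≤-reflexive; ≤∧≢⇒<; all?; any?;
         ¬∀⟶∃¬-smallest; toℕ-injective; toℕ-inject; toℕ-fromℕ<; punchInᵢ≢i)
open import Data.List using (map; allFin; tabulate)
open import Data.List.Properties using (map-tabulate)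
open import Data.Maybe using (Maybe; just; nothing; maybe; Is-just)
import Data.Maybe.Relation.Unary.Any as Any
open import Data.Nat.Divisibility using (_∣_; divides)
open import Data.Nat.ListAction using (sum)
open import Data.Nat.Properties using (+-0-commutativeMonoid; +-identityʳ; <⇒≤; ≤-<-trans)
open import Data.Parity as ℙ using (Parity; 0ℙ; 1ℙ)
open import Data.Parity.Properties using (+-homo-+; *-homo-*; p+p≡0ℙ)
open import Data.Product using (_×_; _,_; proj₁; proj₂; ∃)
open import Data.Sum using (_⊎_; inj₁; inj₂)
open import Data.Unit using (tt)
open import Function.Base using (_∘_; case_of_)
open import Relation.Binary using (tri<; tri≈; tri>)
open import Relation.Binary.Bundles using (Setoid)
open import Relation.Binary.PropositionalEquality
import Relation.Binary.Reasoning.Setoid as SetoidReasoning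
open import Relation.Nullary using (¬_; Dec; yes; no; does)
open import Relation.Nullary.Decidable
  using (dec-true; dec-false; decidable-stable; toWitness; isYes≗does; _×-dec_; _→-dec_; ¬?)
open import Relation.Nullary.Decidable.Core using (T?)

open CommutativeMonoidSum +-0-commutativeMonoid
  using (sum-cong-≗; sum-remove; sum-replicate-zero; ∑-distrib-+)
  renaming (sum to ∑)

sum-map-allFin : ∀ {n} (f : Fin n → ℕ) → sum (map f (allFin n)) ≡ ∑ f
sum-map-allFin f = trans (cong sum (map-tabulate (λ i → i) f)) (sum-tabulate f)
  where
  sum-tabulate : ∀ {n} (f : Fin n → ℕ) → sum (tabulate f) ≡ ∑ f
  sum-tabulate {zero}  f = refl
  sum-tabulate {suc n} f = cong (f zero +_) (sum-tabulate (f ∘ suc))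

∑-zero : ∀ {n} {f : Fin n → ℕ} → (∀ k → f k ≡ 0) → ∑ f ≡ 0
∑-zero {n} f≗0 = trans (sum-cong-≗ f≗0) (sum-replicate-zero n)

∑-supported : ∀ {n} {f : Fin n → ℕ} (m : Fin n) → (∀ k → k ≢ m → f k ≡ 0) → ∑ f ≡ f m
∑-supported {suc n} {f} m f≗0 = begin
  ∑ f                               ≡⟨ sum-remove f ⟩
  f m + ∑ (λ k → f (punchIn m k))   ≡⟨ cong (f m +_) (∑-zero (λ k → f≗0 _ (punchInᵢ≢i m k))) ⟩
  f m + 0                           ≡⟨ +-identityʳ (f m) ⟩
  f m                               ∎
  where open ≡-Reasoning

2∣⇒parity≡0ℙ : ∀ {n} → 2 ∣ n → parity n ≡ 0ℙ
2∣⇒parity≡0ℙ (divides q refl) = trans (*-homo-* q 2) (*-zeroʳ (parity q))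
  where
  *-zeroʳ : ∀ p → p ℙ.* 0ℙ ≡ 0ℙ
  *-zeroʳ 0ℙ = refl
  *-zeroʳ 1ℙ = refl

parity≡0ℙ⇒2∣ : ∀ n → parity n ≡ 0ℙ → 2 ∣ n
parity≡0ℙ⇒2∣ zero          _  = divides 0 refl
parity≡0ℙ⇒2∣ (suc zero)    ()
parity≡0ℙ⇒2∣ (suc (suc n)) eq with parity≡0ℙ⇒2∣ n eq
... | divides q refl = divides (suc q) refl

2∣+⇒parity≡ : ∀ m n → 2 ∣ m + n → parity m ≡ parity n
2∣+⇒parity≡ m n 2∣m+n = +≡0ℙ⇒≡ (parity m) (parity n) (trans (sym (+-homo-+ m n)) (2∣⇒parity≡0ℙ 2∣m+n))
  where
  +≡0ℙ⇒≡ : ∀ p q → p ℙ.+ q ≡ 0ℙ → p ≡ q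
  +≡0ℙ⇒≡ 0ℙ 0ℙ _ = refl
  +≡0ℙ⇒≡ 1ℙ 1ℙ _ = refl

parity≡⇒2∣+ : ∀ m n → parity m ≡ parity n → 2 ∣ m + n
parity≡⇒2∣+ m n eq = parity≡0ℙ⇒2∣ (m + n) (begin
  parity (m + n)          ≡⟨ +-homo-+ m n ⟩
  parity m ℙ.+ parity n   ≡⟨ cong (ℙ._+ parity n) eq ⟩
  parity n ℙ.+ parity n   ≡⟨ p+p≡0ℙ (parity n) ⟩
  0ℙ                      ∎)
  where open ≡-Reasoning

uIndicator : Deg → ℕ
uIndicator d = if isU d then 1 else 0

fromParity : Parity → Deg
fromParity 0ℙ = E
fromParity 1ℙ = U

fromParity≢zro : ∀ p → fromParity p ≢ zro
fromParity≢zro 0ℙ ()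
fromParity≢zro 1ℙ ()

parity-uIndicator-fromParity : ∀ p → parity (uIndicator (fromParity p)) ≡ p
parity-uIndicator-fromParity 0ℙ = refl
parity-uIndicator-fromParity 1ℙ = refl

fromParity-parity-uIndicator : ∀ {d} → d ≢ zro → fromParity (parity (uIndicator d)) ≡ d
fromParity-parity-uIndicator {zro} d≢zro = ⊥-elim (d≢zro refl)
fromParity-parity-uIndicator {U}   _     = refl
fromParity-parity-uIndicator {E}   _     = refl

colour : Deg → Color
colour U = white
colour _ = black

colourDeg : Color → Deg
colourDeg white = U
colourDeg black = E

whiteIndicator : Maybe Color → ℕ
whiteIndicator (just white) = 1
whiteIndicator _            = 0

colourDeg≢zro : ∀ c → colourDeg c ≢ zro
colourDeg≢zro white ()
colourDeg≢zro black ()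

colourDeg-colour : ∀ {d} → d ≢ zro → colourDeg (colour d) ≡ d
colourDeg-colour {zro} d≢zro = ⊥-elim (d≢zro refl)
colourDeg-colour {U}   _     = refl
colourDeg-colour {E}   _     = refl

colour-colourDeg : ∀ c → colour (colourDeg c) ≡ c
colour-colourDeg white = refl
colour-colourDeg black = refl

whiteIndicator-colour : ∀ d → whiteIndicator (just (colour d)) ≡ uIndicator d
whiteIndicator-colour zro = refl
whiteIndicator-colour U   = refl
whiteIndicator-colour E   = refl

uIndicator-colourDeg : ∀ c → uIndicator (colourDeg c) ≡ whiteIndicator (just c)
uIndicator-colourDeg white = refl
uIndicator-colourDeg black = refl

T-injective : ∀ {a b} → (T a → T b) → (T b → T a) → a ≡ b
T-injective {false} {false} _   _   = refl
T-injective {false} {true}  _   b⇒a = ⊥-elim (b⇒a tt)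
T-injective {true}  {false} a⇒b _   = ⊥-elim (a⇒b tt)
T-injective {true}  {true}  _   _   = refl

module _ {h : ℕ} (x : Fin h → Deg) (R : Fin h → Fin h → Bool) where

  summandU : Fin h → Fin h → ℕ
  summandU i j = if R i j ∧ isU (x j) then 1 else 0

  summandU-related : ∀ {i j} → T (R i j) → summandU i j ≡ uIndicator (x j)
  summandU-related Rij rewrite Equivalence.to T-≡ Rij = refl

  summandU-unrelated : ∀ {i j} → ¬ T (R i j) → summandU i j ≡ 0
  summandU-unrelated {i} {j} ¬Rij rewrite T-injective {R i j} ¬Rij λ () = refl

  countU-decompose : ∀ i m (w : Fin h → ℕ) → T (R i m) → w m ≡ 0 →
                     (∀ j → j ≢ m → w j ≡ summandU i j) → countU x R i ≡ uIndicator (x m) + ∑ w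
  countU-decompose i m w Rim wm≡0 w≗ = begin
    countU x R i               ≡⟨ sum-map-allFin (summandU i) ⟩
    ∑ (summandU i)             ≡⟨ sum-cong-≗ summand≗ ⟩
    ∑ (λ j → δ j + w j)        ≡⟨ ∑-distrib-+ δ w ⟩
    ∑ δ + ∑ w                  ≡⟨ cong (_+ ∑ w) (∑-supported m δ-supported) ⟩
    δ m + ∑ w                  ≡⟨ cong (λ b → (if b then uIndicator (x m) else 0) + ∑ w) (dec-true (m ≟ m) refl) ⟩
    uIndicator (x m) + ∑ w     ∎
    where
    open ≡-Reasoning
    δ : Fin h → ℕ
    δ j = if does (j ≟ m) then uIndicator (x m) else 0
    δ-supported : ∀ j → j ≢ m → δ j ≡ 0
    δ-supported j j≢m rewrite dec-false (j ≟ m) j≢m = refl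
    summand≗ : ∀ j → summandU i j ≡ δ j + w j
    summand≗ j with j ≟ m
    ... | yes refl rewrite wm≡0 = trans (summandU-related Rim) (sym (+-identityʳ _))
    ... | no j≢m  = sym (w≗ j j≢m)

inject-fromℕ< : ∀ {n} {ℓ k : Fin n} (k<ℓ : k < ℓ) → F.inject {i = ℓ} (F.fromℕ< k<ℓ) ≡ k
inject-fromℕ< k<ℓ = toℕ-injective (trans (toℕ-inject (F.fromℕ< k<ℓ)) (toℕ-fromℕ< k<ℓ))

module Leaders {h : ℕ} (s : Ω h) where

  IsLeader : Fin h → Set
  IsLeader a = ∀ j → j < a → ¬ T (R s a j)

  isLeader? : ∀ a → Dec (IsLeader a)
  isLeader? a = all? (λ j → (j <? a) →-dec ¬? (T? (R s a j)))

  leader-unique : ∀ {a b} → IsLeader a → IsLeader b → T (R s a b) → a ≡ b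
  leader-unique {a} {b} a-leader b-leader Rab with <-cmp a b
  ... | tri< a<b _ _ = ⊥-elim (b-leader a a<b (R-sym s a b Rab))
  ... | tri≈ _ a≡b _ = a≡b
  ... | tri> _ _ b<a = ⊥-elim (a-leader b b<a Rab)

  leader-exists : ∀ j → x s j ≢ zro → ∃ λ ℓ → T (R s j ℓ) × IsLeader ℓ
  leader-exists j xj≢0
    with ¬∀⟶∃¬-smallest h (λ k → ¬ T (R s j k)) (λ k → ¬? (T? (R s j k))) (λ ∄R → ∄R j (R-refl s j xj≢0))
  ... | ℓ , ¬¬Rjℓ , none-below = ℓ , Rjℓ , ℓ-leader
    where
    Rjℓ : T (R s j ℓ)
    Rjℓ = decidable-stable (T? (R s j ℓ)) ¬¬Rjℓ
    ℓ-leader : IsLeader ℓ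
    ℓ-leader k k<ℓ Rℓk =
      none-below (F.fromℕ< k<ℓ) (subst (T ∘ R s j) (sym (inject-fromℕ< k<ℓ)) (R-trans s j ℓ k Rjℓ Rℓk))

  leader<member : ∀ {m k} → IsLeader m → T (R s m k) → k ≢ m → m < k
  leader<member {m} {k} m-leader Rmk k≢m with <-cmp m k
  ... | tri< m<k _ _ = m<k
  ... | tri≈ _ m≡k _ = ⊥-elim (k≢m (sym m≡k))
  ... | tri> _ _ k<m = ⊥-elim (m-leader k k<m Rmk)

  Arc : Fin h → Fin h → Set
  Arc a b = a < b × T (R s a b) × IsLeader a

  arc? : ∀ a b → Dec (Arc a b)
  arc? a b = (a <? b) ×-dec T? (R s a b) ×-dec isLeader? a

  leader-¬arc-into : ∀ {a c} → IsLeader a → ¬ Arc c a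
  leader-¬arc-into {a} {c} a-leader (c<a , Rca , _) = a-leader c c<a (R-sym s c a Rca)

  arcColour : Fin h → Fin h → Maybe Color
  arcColour a b with arc? a b
  ... | yes _ = just (colour (x s b))
  ... | no _  = nothing

  arcColour-arc : ∀ {a b} → Arc a b → arcColour a b ≡ just (colour (x s b))
  arcColour-arc {a} {b} arc with arc? a b
  ... | yes _   = refl
  ... | no ¬arc = ⊥-elim (¬arc arc)

  arcColour-¬arc : ∀ {a b} → ¬ Arc a b → arcColour a b ≡ nothing
  arcColour-¬arc {a} {b} ¬arc with arc? a b
  ... | yes arc = ⊥-elim (¬arc arc)
  ... | no _    = refl

  Is-just⇒arc : ∀ a b → Is-just (arcColour a b) → Arc a b
  Is-just⇒arc a b arc-exists with arc? a b
  ... | yes arc = arc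

  arcs-noncrossing : ∀ a b c d → a < b → b < c → c < d → ¬ (Arc a c × Arc b d)
  arcs-noncrossing a b c d a<b b<c c<d ((_ , Rac , _) , (_ , Rbd , b-leader)) with T? (R s a b)
  ... | yes Rab = b-leader a a<b (R-sym s a b Rab)
  ... | no ¬Rab = noncrossing s a b c d a<b b<c c<d (Rac , Rbd , ¬Rab)

  arcs-share-left : ∀ {a b c d} → Arc a b → Arc c d → ¬ (a ≡ c × b ≡ d) →
                    ∀ p → (p ≡ a ⊎ p ≡ b) → (p ≡ c ⊎ p ≡ d) → (p ≡ a × p ≡ c)
  arcs-share-left _ _ _ _ (inj₁ refl) (inj₁ refl) = refl , refl
  arcs-share-left (_ , _ , a-leader) cd _ _ (inj₁ refl) (inj₂ refl) = ⊥-elim (leader-¬arc-into a-leader cd)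
  arcs-share-left ab (_ , _ , c-leader) _ _ (inj₂ refl) (inj₁ refl) = ⊥-elim (leader-¬arc-into c-leader ab)
  arcs-share-left {a} {b} {c} (_ , Rab , a-leader) (_ , Rcb , c-leader) ab≢cd _ (inj₂ refl) (inj₂ refl) =
    ⊥-elim (ab≢cd (leader-unique a-leader c-leader (R-trans s a b c Rab (R-sym s c b Rcb)) , refl))

  toF4 : F4 h
  toF4 = record
    { col         = arcColour
    ; col-ordered = λ a b ab → proj₁ (Is-just⇒arc a b ab)
    ; noncrossing = λ a b c d a<b b<c c<d (ac , bd) →
                      arcs-noncrossing a b c d a<b b<c c<d (Is-just⇒arc a c ac , Is-just⇒arc b d bd)
    ; shared-left = λ a b c d ab cd → arcs-share-left (Is-just⇒arc a b ab) (Is-just⇒arc c d cd)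
    }

  whiteIndicator-arcs : ∀ {m} → IsLeader m → ∀ k → k ≢ m →
                        whiteIndicator (arcColour m k) ≡ summandU (x s) (R s) m k
  whiteIndicator-arcs {m} m-leader k k≢m = by-cases (T? (R s m k))
    where
    by-cases : Dec (T (R s m k)) → whiteIndicator (arcColour m k) ≡ summandU (x s) (R s) m k
    by-cases (yes Rmk) =
      trans (cong whiteIndicator (arcColour-arc (leader<member m-leader Rmk k≢m , Rmk , m-leader)))
            (trans (whiteIndicator-colour (x s k)) (sym (summandU-related (x s) (R s) Rmk)))
    by-cases (no ¬Rmk) =
      trans (cong whiteIndicator (arcColour-¬arc (¬Rmk ∘ proj₁ ∘ proj₂)))
            (sym (summandU-unrelated (x s) (R s) ¬Rmk))

  countU-leader : ∀ {m} → x s m ≢ zro → IsLeader m →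
                  countU (x s) (R s) m ≡ uIndicator (x s m) + ∑ (λ k → whiteIndicator (arcColour m k))
  countU-leader {m} xm≢0 m-leader =
    countU-decompose (x s) (R s) m m (λ k → whiteIndicator (arcColour m k)) (R-refl s m xm≢0)
      (cong whiteIndicator (arcColour-¬arc (λ (m<m , _) → <-irrefl refl m<m))) (whiteIndicator-arcs m-leader)

module Stars {h : ℕ} (y : F4 h) where

  Edge : Fin h → Fin h → Set
  Edge a b = Is-just (col y a b)

  edge? : ∀ a b → Dec (Edge a b)
  edge? a b = Any.dec (λ _ → yes tt) (col y a b)

  edge< : ∀ {a b} → Edge a b → a < b
  edge< {a} {b} = col-ordered y a b

  ¬edge⇒nothing : ∀ {a b} → ¬ Edge a b → col y a b ≡ nothing
  ¬edge⇒nothing {a} {b} ¬ab with col y a b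
  ... | just _  = ⊥-elim (¬ab (Any.just tt))
  ... | nothing = refl

  col-diagonal : ∀ j → col y j j ≡ nothing
  col-diagonal j = ¬edge⇒nothing (λ jj → <-irrefl refl (edge< jj))

  edge-left-unique : ∀ {k k' j} → Edge k j → Edge k' j → k ≡ k'
  edge-left-unique {k} {k'} {j} kj k'j with k ≟ k'
  ... | yes k≡k' = k≡k'
  ... | no k≢k'  = ⊥-elim (<⇒≢ (edge< kj) (sym (proj₁ j≡k×j≡k')))
    where
    j≡k×j≡k' = shared-left y k j k' j kj k'j (k≢k' ∘ proj₁) j (inj₂ refl) (inj₂ refl)

  edge-¬path : ∀ {l k j} → Edge l k → ¬ Edge k j
  edge-¬path {l} {k} {j} lk kj = <⇒≢ (edge< lk) (sym (proj₂ k≡k×k≡l))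
    where
    k≡k×k≡l = shared-left y k j l k kj lk (λ (_ , j≡k) → <⇒≢ (edge< kj) (sym j≡k)) k (inj₁ refl) (inj₂ refl)

  IsRoot : Fin h → Set
  IsRoot j = ∀ k → ¬ Edge k j

  root : Fin h → Fin h
  root j with any? (λ k → edge? k j)
  ... | yes (k , _) = k
  ... | no _        = j

  root-spec : ∀ j → Edge (root j) j ⊎ (root j ≡ j × IsRoot j)
  root-spec j with any? (λ k → edge? k j)
  ... | yes (_ , kj) = inj₁ kj
  ... | no ∄k        = inj₂ (refl , λ k kj → ∄k (k , kj))

  root-edge : ∀ {k j} → Edge k j → root j ≡ k
  root-edge {k} {j} kj with root-spec j
  ... | inj₁ rj           = edge-left-unique rj kj
  ... | inj₂ (_ , j-root) = ⊥-elim (j-root k kj)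

  isRoot⇒root≡ : ∀ {j} → IsRoot j → root j ≡ j
  isRoot⇒root≡ {j} j-root with root-spec j
  ... | inj₁ rj         = ⊥-elim (j-root (root j) rj)
  ... | inj₂ (rj≡j , _) = rj≡j

  root-isRoot : ∀ j → IsRoot (root j)
  root-isRoot j with root-spec j
  ... | inj₁ rj              = λ k k-rj → edge-¬path k-rj rj
  ... | inj₂ (rj≡j , j-root) = subst IsRoot (sym rj≡j) j-root

  root-idem : ∀ j → root (root j) ≡ root j
  root-idem j = isRoot⇒root≡ (root-isRoot j)

  root≤ : ∀ j → root j F.≤ j
  root≤ j with root-spec j
  ... | inj₁ rj         = <⇒≤ (edge< rj)
  ... | inj₂ (rj≡j , _) = ≤-reflexive rj≡j

  root≢⇒edge : ∀ {j} → root j ≢ j → Edge (root j) j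
  root≢⇒edge {j} rj≢j with root-spec j
  ... | inj₁ rj         = rj
  ... | inj₂ (rj≡j , _) = ⊥-elim (rj≢j rj≡j)

  star-member-edge : ∀ {i j} → root i ≡ root j → j ≢ root i → Edge (root i) j
  star-member-edge {i} {j} ri≡rj j≢ri = subst (λ r → Edge r j) (sym ri≡rj) (root≢⇒edge rj≢j)
    where
    rj≢j : root j ≢ j
    rj≢j rj≡j = j≢ri (trans (sym rj≡j) (sym ri≡rj))

  edge-from-root : ∀ {a j} → root a ≡ root j → a < j → Edge (root a) j
  edge-from-root {a} ra≡rj a<j = star-member-edge ra≡rj (λ j≡ra → <⇒≢ (≤-<-trans (root≤ a) a<j) (sym j≡ra))

  sameStar : Fin h → Fin h → Bool
  sameStar i j = does (root i ≟ root j)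

  sameStar⇒≡ : ∀ {i j} → T (sameStar i j) → root i ≡ root j
  sameStar⇒≡ {i} {j} = toWitness {a? = root i ≟ root j} ∘ subst T (sym (isYes≗does (root i ≟ root j)))

  ≡⇒sameStar : ∀ {i j} → root i ≡ root j → T (sameStar i j)
  ≡⇒sameStar {i} {j} ri≡rj = subst T (sym (dec-true (root i ≟ root j) ri≡rj)) tt

  whiteDegree : Fin h → ℕ
  whiteDegree j = ∑ (λ k → whiteIndicator (col y j k))

  -- For a root j, col y (root j) j = col y j j = nothing, so exactly the roots fall back
  -- on the parity of their white arcs.
  degree : Fin h → Deg
  degree j = maybe colourDeg (fromParity (parity (whiteDegree j))) (col y (root j) j)

  degree≢zro : ∀ j → degree j ≢ zro
  degree≢zro j with col y (root j) j
  ... | just c  = colourDeg≢zro c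
  ... | nothing = fromParity≢zro _

  degree-child : ∀ {k j c} → col y k j ≡ just c → degree j ≡ colourDeg c
  degree-child {k} {j} kj≡c rewrite root-edge (subst Is-just (sym kj≡c) (Any.just tt)) | kj≡c = refl

  degree-root : ∀ {j} → IsRoot j → degree j ≡ fromParity (parity (whiteDegree j))
  degree-root {j} j-root rewrite isRoot⇒root≡ j-root | col-diagonal j = refl

  whiteIndicator-edge : ∀ {k j} → Edge k j → whiteIndicator (col y k j) ≡ uIndicator (degree j)
  whiteIndicator-edge {k} {j} kj with col y k j in kj≡c
  ... | just c = trans (sym (uIndicator-colourDeg c)) (cong uIndicator (sym (degree-child kj≡c)))

  stars-noncrossing : ∀ a b c d → a < b → b < c → c < d →
                      ¬ (T (sameStar a c) × T (sameStar b d) × ¬ T (sameStar a b))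
  stars-noncrossing a b c d a<b b<c c<d (ac , bd , ¬ab) with <-cmp (root a) (root b)
  ... | tri≈ _ ra≡rb _ = ¬ab (≡⇒sameStar ra≡rb)
  ... | tri< ra<rb _ _ =
    noncrossing y (root a) (root b) c d ra<rb (≤-<-trans (root≤ b) b<c) c<d
      (edge-from-root (sameStar⇒≡ ac) (<-trans a<b b<c) , edge-from-root (sameStar⇒≡ bd) (<-trans b<c c<d))
  ... | tri> _ _ rb<ra =
    noncrossing y (root b) (root a) b c rb<ra ra<b b<c
      (root≢⇒edge (<⇒≢ (<-trans rb<ra ra<b)) , edge-from-root (sameStar⇒≡ ac) (<-trans a<b b<c))
    where
    ra<b : root a < b
    ra<b = ≤-<-trans (root≤ a) a<b

  whiteIndicator-star : ∀ i j → j ≢ root i → whiteIndicator (col y (root i) j) ≡ summandU degree sameStar i j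
  whiteIndicator-star i j j≢ri with edge? (root i) j
  ... | yes ri-j =
    trans (whiteIndicator-edge ri-j) (sym (summandU-related degree sameStar (≡⇒sameStar (sym (root-edge ri-j)))))
  ... | no ¬ri-j =
    trans (cong whiteIndicator (¬edge⇒nothing ¬ri-j))
          (sym (summandU-unrelated degree sameStar λ same → ¬ri-j (star-member-edge (sameStar⇒≡ same) j≢ri)))

  countU-star : ∀ i → countU degree sameStar i ≡ uIndicator (degree (root i)) + whiteDegree (root i)
  countU-star i = countU-decompose degree sameStar i (root i) (λ j → whiteIndicator (col y (root i) j))
                    (≡⇒sameStar (sym (root-idem i))) (cong whiteIndicator (col-diagonal (root i)))
                    (whiteIndicator-star i)

  stars-evenU : ∀ i → 2 ∣ countU degree sameStar i
  stars-evenU i rewrite countU-star i | degree-root (root-isRoot i) =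
    parity≡⇒2∣+ _ (whiteDegree (root i)) (parity-uIndicator-fromParity (parity (whiteDegree (root i))))

  stars-singletonE : ∀ i → (∀ j → T (sameStar i j) → j ≡ i) → degree i ≡ E
  stars-singletonE i singleton = begin
    degree i                              ≡⟨ degree-root i-root ⟩
    fromParity (parity (whiteDegree i))   ≡⟨ cong (fromParity ∘ parity) (∑-zero no-white-arc) ⟩
    E                                     ∎
    where
    open ≡-Reasoning
    ri≡i : root i ≡ i
    ri≡i = singleton (root i) (≡⇒sameStar (sym (root-idem i)))
    i-root : IsRoot i
    i-root = subst IsRoot ri≡i (root-isRoot i)
    no-white-arc : ∀ k → whiteIndicator (col y i k) ≡ 0
    no-white-arc k = cong whiteIndicator (¬edge⇒nothing λ ik →
      <⇒≢ (edge< ik) (sym (singleton k (≡⇒sameStar (trans ri≡i (sym (root-edge ik)))))))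

  fromF4 : Ωpos h
  fromF4 = record
    { x           = degree
    ; R           = sameStar
    ; R-supp      = λ i j _ → degree≢zro i , degree≢zro j
    ; R-refl      = λ i _ → ≡⇒sameStar refl
    ; R-sym       = λ i j ij → ≡⇒sameStar (sym (sameStar⇒≡ ij))
    ; R-trans     = λ i j k ij jk → ≡⇒sameStar (trans (sameStar⇒≡ ij) (sameStar⇒≡ jk))
    ; noncrossing = stars-noncrossing
    ; evenU       = λ i _ → stars-evenU i
    ; singletonE  = λ i _ → stars-singletonE i
    } , degree≢zro

module RoundTripΩ {h : ℕ} (s : Ω h) (pos : ∀ i → x s i ≢ zro) where
  open Leaders s
  open Stars toF4

  leader : Fin h → Fin h
  leader j = proj₁ (leader-exists j (pos j))

  R-leader : ∀ j → T (R s j (leader j))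
  R-leader j = proj₁ (proj₂ (leader-exists j (pos j)))

  leader-isLeader : ∀ j → IsLeader (leader j)
  leader-isLeader j = proj₂ (proj₂ (leader-exists j (pos j)))

  R-leader⁻¹ : ∀ j → T (R s (leader j) j)
  R-leader⁻¹ j = R-sym s j (leader j) (R-leader j)

  leader-cases : ∀ j → Arc (leader j) j ⊎ (leader j ≡ j × IsLeader j)
  leader-cases j with <-cmp (leader j) j
  ... | tri< ℓ<j _ _ = inj₁ (ℓ<j , R-leader⁻¹ j , leader-isLeader j)
  ... | tri≈ _ ℓ≡j _ = inj₂ (ℓ≡j , subst IsLeader ℓ≡j (leader-isLeader j))
  ... | tri> _ _ j<ℓ = ⊥-elim (leader-isLeader j j j<ℓ (R-leader⁻¹ j))

  leader≡⇒R : ∀ {i j} → leader i ≡ leader j → T (R s i j)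
  leader≡⇒R {i} {j} ℓi≡ℓj = R-trans s i (leader j) j (subst (T ∘ R s i) ℓi≡ℓj (R-leader i)) (R-leader⁻¹ j)

  R⇒leader≡ : ∀ {i j} → T (R s i j) → leader i ≡ leader j
  R⇒leader≡ {i} {j} Rij = leader-unique (leader-isLeader i) (leader-isLeader j)
    (R-trans s (leader i) i (leader j) (R-leader⁻¹ i) (R-trans s i j (leader j) Rij (R-leader j)))

  arc⇒edge : ∀ {a b} → Arc a b → Edge a b
  arc⇒edge arc = subst Is-just (sym (arcColour-arc arc)) (Any.just tt)

  leader-isRoot : ∀ {a} → IsLeader a → IsRoot a
  leader-isRoot a-leader k ka = leader-¬arc-into a-leader (Is-just⇒arc k _ ka)

  root≡leader : ∀ j → root j ≡ leader j
  root≡leader j with leader-cases j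
  ... | inj₁ arc              = root-edge (arc⇒edge arc)
  ... | inj₂ (ℓ≡j , j-leader) = trans (isRoot⇒root≡ (leader-isRoot j-leader)) (sym ℓ≡j)

  sameStar≡R : ∀ i j → sameStar i j ≡ R s i j
  sameStar≡R i j = T-injective
    (λ same → leader≡⇒R (trans (sym (root≡leader i)) (trans (sameStar⇒≡ same) (root≡leader j))))
    (λ Rij → ≡⇒sameStar (trans (root≡leader i) (trans (R⇒leader≡ Rij) (sym (root≡leader j)))))

  degree≡x : ∀ j → degree j ≡ x s j
  degree≡x j with leader-cases j
  ... | inj₁ arc = trans (degree-child (arcColour-arc arc)) (colourDeg-colour (pos j))
  ... | inj₂ (_ , j-leader) = begin
    degree j                                   ≡⟨ degree-root (leader-isRoot j-leader) ⟩
    fromParity (parity (whiteDegree j))        ≡⟨ cong fromParity parity-uIndicator≡ ⟨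
    fromParity (parity (uIndicator (x s j)))   ≡⟨ fromParity-parity-uIndicator (pos j) ⟩
    x s j                                      ∎
    where
    open ≡-Reasoning
    parity-uIndicator≡ : parity (uIndicator (x s j)) ≡ parity (whiteDegree j)
    parity-uIndicator≡ = 2∣+⇒parity≡ (uIndicator (x s j)) (whiteDegree j)
                           (subst (2 ∣_) (countU-leader (pos j) j-leader) (evenU s j (pos j)))

module RoundTripF4 {h : ℕ} (y : F4 h) where
  open Stars y
  open Leaders (proj₁ fromF4)

  root≡⇒isLeader : ∀ {a} → root a ≡ a → IsLeader a
  root≡⇒isLeader {a} ra≡a j j<a same = <-irrefl (trans (sym (sameStar⇒≡ same)) ra≡a) (≤-<-trans (root≤ j) j<a)

  isLeader⇒root≡ : ∀ {a} → IsLeader a → root a ≡ a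
  isLeader⇒root≡ {a} a-leader = decidable-stable (root a ≟ a) λ ra≢a →
    a-leader (root a) (≤∧≢⇒< (root≤ a) ra≢a) (≡⇒sameStar (sym (root-idem a)))

  edge⇒arc : ∀ {a b} → Edge a b → Arc a b
  edge⇒arc {a} ab = edge< ab , ≡⇒sameStar (trans ra≡a (sym (root-edge ab))) , root≡⇒isLeader ra≡a
    where
    ra≡a : root a ≡ a
    ra≡a = isRoot⇒root≡ (λ k ka → edge-¬path ka ab)

  arc⇒edge : ∀ {a b} → Arc a b → Edge a b
  arc⇒edge {a} {b} (a<b , same , a-leader) =
    subst (λ r → Edge r b) (isLeader⇒root≡ a-leader) (edge-from-root (sameStar⇒≡ same) a<b)

  arcColour≡col : ∀ a b → arcColour a b ≡ col y a b
  arcColour≡col a b = by-cases (col y a b) refl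
    where
    by-cases : ∀ m → col y a b ≡ m → arcColour a b ≡ m
    by-cases (just c) ab≡c = trans (arcColour-arc (edge⇒arc (subst Is-just (sym ab≡c) (Any.just tt))))
                                   (cong just (trans (cong colour (degree-child ab≡c)) (colour-colourDeg c)))
    by-cases nothing ab≡∅ = arcColour-¬arc (λ arc → case subst Is-just ab≡∅ (arc⇒edge arc) of λ ())

open Leaders using (toF4)
open Stars using (fromF4)

module _ {h : ℕ} where
  open Setoid (Ωpos-setoid h) using () renaming (_≈_ to _≈Ω_)
  open Setoid (F4-setoid h) using () renaming (_≈_ to _≈F4_)

  fromF4-toF4 : ∀ s → fromF4 (toF4 (proj₁ s)) ≈Ω s
  fromF4-toF4 (s , pos) = RoundTripΩ.degree≡x s pos , RoundTripΩ.sameStar≡R s pos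

  toF4-fromF4 : ∀ y → toF4 (proj₁ (fromF4 y)) ≈F4 y
  toF4-fromF4 = RoundTripF4.arcColour≡col

  arc-transfer : ∀ {s t : Ω h} → (∀ i j → R s i j ≡ R t i j) →
                 ∀ {a b} → Leaders.Arc s a b → Leaders.Arc t a b
  arc-transfer R≗ {a} (a<b , Rab , a-leader) =
    a<b , subst T (R≗ a _) Rab , λ j j<a Raj → a-leader j j<a (subst T (sym (R≗ a j)) Raj)

  toF4-cong : ∀ s t → s ≈Ω t → toF4 (proj₁ s) ≈F4 toF4 (proj₁ t)
  toF4-cong (s , _) (t , _) (x≗ , R≗) a b with Leaders.arc? s a b | Leaders.arc? t a b
  ... | yes _   | yes _   = cong (just ∘ colour) (x≗ b)
  ... | yes arc | no ¬arc = ⊥-elim (¬arc (arc-transfer {s} {t} R≗ arc))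
  ... | no ¬arc | yes arc = ⊥-elim (¬arc (arc-transfer {t} {s} (λ i j → sym (R≗ i j)) arc))
  ... | no _    | no _    = refl

  root-cong : ∀ {y y'} → y ≈F4 y' → ∀ j → Stars.root y j ≡ Stars.root y' j
  root-cong {y} {y'} col≗ j with Stars.root-spec y' j
  ... | inj₁ r'j = Stars.root-edge y (subst Is-just (sym (col≗ _ j)) r'j)
  ... | inj₂ (r'≡j , j-root') =
    trans (Stars.isRoot⇒root≡ y λ k kj → j-root' k (subst Is-just (col≗ k j) kj)) (sym r'≡j)

  fromF4-cong : ∀ y y' → y ≈F4 y' → fromF4 y ≈Ω fromF4 y'
  fromF4-cong y y' col≗ =
    degree-cong , λ i j → cong₂ (λ p q → does (p ≟ q)) (root-cong col≗ i) (root-cong col≗ j)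
    where
    degree-cong : ∀ j → Stars.degree y j ≡ Stars.degree y' j
    degree-cong j = cong₂ (maybe colourDeg)
      (cong (fromParity ∘ parity) (sum-cong-≗ (λ k → cong whiteIndicator (col≗ j k))))
      (trans (col≗ (Stars.root y j) j) (cong (λ r → col y' r j) (root-cong col≗ j)))

  toF4-injective : ∀ s t → toF4 (proj₁ s) ≈F4 toF4 (proj₁ t) → s ≈Ω t
  toF4-injective s t to-s≈to-t = begin
    s                          ≈⟨ fromF4-toF4 s ⟨
    fromF4 (toF4 (proj₁ s))    ≈⟨ fromF4-cong _ _ to-s≈to-t ⟩
    fromF4 (toF4 (proj₁ t))    ≈⟨ fromF4-toF4 t ⟩
    t                          ∎
    where open SetoidReasoning (Ωpos-setoid h)

  toF4-onto : ∀ y s → s ≈Ω fromF4 y → toF4 (proj₁ s) ≈F4 y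
  toF4-onto y s s≈from-y = begin
    toF4 (proj₁ s)            ≈⟨ toF4-cong s (fromF4 y) s≈from-y ⟩
    toF4 (proj₁ (fromF4 y))   ≈⟨ toF4-fromF4 y ⟩
    y                         ∎
    where open SetoidReasoning (F4-setoid h)

lemma6 : (h : ℕ) → 1 ≤ h → Bijection (Ωpos-setoid h) (F4-setoid h)
lemma6 h _ = record
  { to        = toF4 ∘ proj₁
  ; cong      = λ {s} {t} → toF4-cong s t
  ; bijective = (λ {s} {t} → toF4-injective s t) , λ y → fromF4 y , λ {s} → toF4-onto y s
  }
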